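{- Let $a=(a_1,a_2)$, $b=(b_1,b_2)$, $c=(c_1,c_2)$ be three points in $\mathbb{R}^2$. Then $a,b,c$ determine a transversal tropical triangle if and only if, perhaps after relabeling the three points, the following inequalities hold: $$a_1<b_1<c_1,\qquad a_2<c_2<b_2,\qquad b_1-b_2<a_1-a_2<c_1-c_2.$$ In particular, the set of $(a_1,a_2,b_1,b_2,c_1,c_2)\in\mathbb{R}^6$ satisfying these inequalities is an open unbounded polyhedron in $\mathbb{R}^6$, invariant under adding $\lambda(1,1,1,1,1,1)$ for every $\lambda\in\mathbb{R}$, so that it may be viewed projectively in $\mathbb{T}\mathbb{P}^5$.
   Context: The tropical semifield is $\mathbb{T}=\mathbb{R}\cup\{ -\infty\}$ with $x\oplus y=\max\{x,y\}$, $x\odot y=x+y$. Identify $\mathbb{R}^2$ with the interior points of the tropical projective plane $\mathbb{T}\mathbb{P}^2$ (which is $\mathbb{T}^3\setminus\{(-\infty,-\infty,-\infty)\}$ modulo adding real multiples of $(1,1,1)$, classes written $[x_1,x_2,x_3]$) via $(x,y)\mapsto[x,y,0]$. A tropical line is a set $\{[x_1,x_2,x_3]:\max\{u_1+x_1,u_2+x_2,u_3+x_3\}\text{ attained at least twice}\}$ with $u_1,u_2,u_3\in\mathbb{R}$ (restricted to $\mathbb{R}^2$ in the affine picture). Two points are transversal if exactly one tropical line passes through both; for transversal points $p,q$ this line is denoted $pq$. Two tropical lines are transversal if they intersect in exactly one point. Three points $a,b,c$ determine a transversal tropical triangle if they are distinct, tropically non-collinear (no tropical line contains all three), pairwise transversal,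 and the three tropical lines $ab,bc,ca$ are pairwise transversal. -}

module Defs where

open import Level using (0ℓ)
open import Data.Product using (Σ; ∃; _×_; _,_; proj₁)
open import Data.Sum using (_⊎_)
open import Relation.Binary.PropositionalEquality using (_≡_; _≢_)
open import Relation.Binary.Structures using (IsStrictTotalOrder)
open import Algebra.Structures using (IsCommutativeRing)

record RealField : Set₁ where
  infixl 6 _+_
  infixl 7 _*_
  infix 8 -_
  infix 4 _<_
  field
    ℝ : Set
    _+_ _*_ : ℝ → ℝ → ℝ
    -_ : ℝ → ℝ
    0r 1r : ℝ
    _<_ : ℝ → ℝ → Set
    isCommutativeRing : IsCommutativeRing _≡_ _+_ _*_ -_ 0r 1r
    isStrictTotalOrder : IsStrictTotalOrder _≡_ _<_
    0<1 : 0r < 1r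
    +-monoˡ-< : ∀ {x y} z → x < y → x + z < y + z
    *-pos : ∀ {x y} → 0r < x → 0r < y → 0r < x * y
    inverse : ∀ x → x ≢ 0r → ∃ λ y → x * y ≡ 1r
    lub : (P : ℝ → Set) → (∃ λ x → P x) →
          (∃ λ M → ∀ x → P x → (x < M ⊎ x ≡ M)) →
          ∃ λ s → (∀ x → P x → (x < s ⊎ x ≡ s)) ×
                  (∀ M → (∀ x → P x → (x < M ⊎ x ≡ M)) → (s < M ⊎ s ≡ M))

module Tropical (R : RealField) where
  open RealField R

  _≤_ : ℝ → ℝ → Set
  x ≤ y = x < y ⊎ x ≡ y

  _-_ : ℝ → ℝ → ℝ
  x - y = x + (- y)

  -- points of ℝ² (identified with [x , y , 0] in TP²)
  Point : Set
  Point = ℝ × ℝ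

  Line : Set
  Line = ℝ × ℝ × ℝ

  MaxTwice : ℝ → ℝ → ℝ → Set
  MaxTwice t₁ t₂ t₃ = (t₁ ≡ t₂ × t₃ ≤ t₁) ⊎ (t₁ ≡ t₃ × t₂ ≤ t₁) ⊎ (t₂ ≡ t₃ × t₁ ≤ t₂)

  OnLine : Line → Point → Set
  OnLine (u₁ , u₂ , u₃) (x , y) = MaxTwice (u₁ + x) (u₂ + y) (u₃ + 0r)

  SameLine : Line → Line → Set
  SameLine u v = ∀ z → (OnLine u z → OnLine v z) × (OnLine v z → OnLine u z)

  TransversalPts : Point → Point → Set
  TransversalPts p q = Σ Line λ u → OnLine u p × OnLine u q ×
                         (∀ v → OnLine v p → OnLine v q → SameLine v u)

  TransversalLines : Line → Line → Set
  TransversalLines u v = Σ Point λ z → OnLine u z × OnLine v z ×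
                           (∀ w → OnLine u w → OnLine v w → w ≡ z)

  Collinear : Point → Point → Point → Set
  Collinear a b c = Σ Line λ u → OnLine u a × OnLine u b × OnLine u c

  TransversalTriangle : Point → Point → Point → Set
  TransversalTriangle a b c =
    a ≢ b × b ≢ c × c ≢ a ×
    (Collinear a b c → Data.Empty.⊥) ×
    Σ (TransversalPts a b) λ tab →
    Σ (TransversalPts b c) λ tbc →
    Σ (TransversalPts c a) λ tca →
      TransversalLines (proj₁ tab) (proj₁ tbc) ×
      TransversalLines (proj₁ tbc) (proj₁ tca) ×
      TransversalLines (proj₁ tca) (proj₁ tab)
    where import Data.Empty

  Ineqs : Point → Point → Point → Set
  Ineqs (a₁ , a₂) (b₁ , b₂) (c₁ , c₂) =
    a₁ < b₁ × b₁ < c₁ × a₂ < c₂ × c₂ < b₂ ×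
    (b₁ - b₂) < (a₁ - a₂) × (a₁ - a₂) < (c₁ - c₂)

  IneqsUpToRelabel : Point → Point → Point → Set
  IneqsUpToRelabel a b c =
    Ineqs a b c ⊎ Ineqs a c b ⊎ Ineqs b a c ⊎
    Ineqs b c a ⊎ Ineqs c a b ⊎ Ineqs c b a

  shift : ℝ → Point → Point
  shift λ' (x , y) = (x + λ' , y + λ')

{-# OPTIONS --safe #-}
-- A tropical line is the union of three closed rays issuing from its vertex, pointing
-- north-east, south and west.  For two points p, q with p₁ < q₁, comparing p₂ with q₂ and
-- p₁ - p₂ with q₁ - q₂ forces the ray that any line through both uses at p and at q.  For a
-- generic pair these rays differ and pin down the vertex, so the line through p and q is
-- unique; a non-generic pair lies on one ray of some line, and moving the vertex backwards
-- along that ray gives a second line through both points.  Two transversal lines through a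
-- common point use different rays there, since otherwise they share a segment.
-- For a triangle with a₁ < b₁ < c₁ this puts a₁ - a₂ between b₁ - b₂ and c₁ - c₂ and c₂
-- between a₂ and b₂, and the only consistent orientation gives the inequalities.
-- Conversely, under the inequalities every corner lies on two different open rays of the
-- two sides through it.  Since w lies on the line with vertex v iff -v lies on the line with
-- vertex -w, the uniqueness argument for points also shows that two such sides meet only
-- at that corner.
module Submission where

open import Defs
open import Data.Product using (Σ; _×_; _,_; proj₁; proj₂)
open import Data.Sum using (_⊎_; inj₁; inj₂)
open import Data.Empty using (⊥-elim)
open import Relation.Nullary using (¬_)
open import Relation.Binary.PropositionalEquality
  using (_≡_; _≢_; refl; sym; trans; cong; cong₂; subst; subst₂; ≢-sym; module ≡-Reasoning)
open import Relation.Binary.Bundles using (StrictTotalOrder)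
open import Relation.Binary.Definitions using (tri<; tri≈; tri>)
open import Relation.Binary.Structures using (IsStrictTotalOrder)
open import Algebra.Bundles using (AbelianGroup)
open import Algebra.Structures using (IsCommutativeRing)
import Algebra.Properties.AbelianGroup as AbelianGroupProperties
import Algebra.Properties.CommutativeSemigroup as CommutativeSemigroupProperties
import Relation.Binary.Properties.StrictTotalOrder as StrictTotalOrderProperties
import Relation.Binary.Reasoning.StrictPartialOrder as StrictReasoning

module TransversalTriangles (R : RealField) where
  open RealField R
  open Tropical R

  +-abelianGroup : AbelianGroup _ _
  +-abelianGroup = record
    { isAbelianGroup = IsCommutativeRing.+-isAbelianGroup isCommutativeRing }

  <-strictTotalOrder : StrictTotalOrder _ _ _
  <-strictTotalOrder = record { isStrictTotalOrder = isStrictTotalOrder }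

  open IsCommutativeRing isCommutativeRing using (+-assoc; +-comm; +-identityˡ; +-identityʳ)
  open AbelianGroupProperties +-abelianGroup
    using (⁻¹-involutive; ⁻¹-injective; ⁻¹-anti-homo‿-; ⁻¹-∙-comm;
           \\-leftDividesˡ; \\-leftDividesʳ; //-rightDividesˡ; //-rightDividesʳ)
  open CommutativeSemigroupProperties (AbelianGroup.commutativeSemigroup +-abelianGroup)
    using (x∙yz≈y∙xz; xy∙z≈xz∙y)
  open IsStrictTotalOrder isStrictTotalOrder using (compare; irrefl) renaming (trans to <-trans)
  open StrictTotalOrderProperties <-strictTotalOrder using ()
    renaming (antisym to ≤-antisym; total to ≤-total)

  variable
    a b c x y z x′ y′ p₁ p₂ q₁ q₂ v₁ v₂ : ℝ

  module _ where
    open ≡-Reasoning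

    a+x-a≡x : ∀ a x → (a + x) - a ≡ x
    a+x-a≡x a x = trans (cong (_- a) (+-comm a x)) (//-rightDividesʳ a x)

    a+[c-a]≡c : ∀ a c → a + (c - a) ≡ c
    a+[c-a]≡c a c = trans (+-comm a (c - a)) (//-rightDividesˡ a c)

    a+x≡b+y⇒x-y≡b-a : a + x ≡ b + y → x - y ≡ b - a
    a+x≡b+y⇒x-y≡b-a {a} {x} {b} {y} e = begin
      x - y               ≡⟨ cong (_- y) (sym (a+x-a≡x a x)) ⟩
      ((a + x) - a) - y   ≡⟨ cong (λ t → (t - a) - y) e ⟩
      ((b + y) - a) - y   ≡⟨ cong (_- y) (xy∙z≈xz∙y b y (- a)) ⟩
      ((b - a) + y) - y   ≡⟨ //-rightDividesʳ y (b - a) ⟩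
      b - a               ∎

    x-y≡b-a⇒a+x≡b+y : x - y ≡ b - a → a + x ≡ b + y
    x-y≡b-a⇒a+x≡b+y {x} {y} {b} {a} e = begin
      a + x               ≡⟨ cong (a +_) (sym (//-rightDividesˡ y x)) ⟩
      a + ((x - y) + y)   ≡⟨ cong (λ t → a + (t + y)) e ⟩
      a + ((b - a) + y)   ≡⟨ sym (+-assoc a (b - a) y) ⟩
      (a + (b - a)) + y   ≡⟨ cong (_+ y) (a+[c-a]≡c a b) ⟩
      b + y               ∎

    [c-a]-[c-b]≡b-a : ∀ a b c → (c - a) - (c - b) ≡ b - a
    [c-a]-[c-b]≡b-a a b c =
      a+x≡b+y⇒x-y≡b-a (trans (a+[c-a]≡c a c) (sym (a+[c-a]≡c b c)))

    [x+k]-[y+k]≡x-y : ∀ x y k → (x + k) - (y + k) ≡ x - y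
    [x+k]-[y+k]≡x-y x y k = a+x≡b+y⇒x-y≡b-a (x∙yz≈y∙xz y x k)

    x-[x-d]≡d : ∀ x d → x - (x - d) ≡ d
    x-[x-d]≡d x d = trans (cong (x +_) (⁻¹-anti-homo‿- x d)) (a+[c-a]≡c x d)

    -x-[-y]≡-[x-y] : ∀ x y → (- x) - (- y) ≡ - (x - y)
    -x-[-y]≡-[x-y] x y = ⁻¹-∙-comm x (- y)

    x-y≡x-y′⇒y≡y′ : x - y ≡ x - y′ → y ≡ y′
    x-y≡x-y′⇒y≡y′ {x} {y} {y′} e = ⁻¹-injective (begin
      - y               ≡⟨ sym (\\-leftDividesʳ x (- y)) ⟩
      - x + (x - y)     ≡⟨ cong (- x +_) e ⟩
      - x + (x - y′)    ≡⟨ \\-leftDividesʳ x (- y′) ⟩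
      - y′              ∎)

    x-y≡x′-y⇒x≡x′ : x - y ≡ x′ - y → x ≡ x′
    x-y≡x′-y⇒x≡x′ {x} {y} {x′} e = begin
      x             ≡⟨ sym (//-rightDividesˡ y x) ⟩
      (x - y) + y   ≡⟨ cong (_+ y) e ⟩
      (x′ - y) + y  ≡⟨ //-rightDividesˡ y x′ ⟩
      x′            ∎

    y+[-x+-y]≡-x : ∀ x y → y + (- x + - y) ≡ - x
    y+[-x+-y]≡-x x y = trans (cong (y +_) (+-comm (- x) (- y))) (\\-leftDividesˡ y (- x))

  open StrictReasoning (StrictTotalOrder.strictPartialOrder <-strictTotalOrder)

  ≤-refl : x ≤ x
  ≤-refl = inj₂ refl

  <⇒≢ : x < y → x ≢ y
  <⇒≢ h e = irrefl e h

  <-asym : x < y → ¬ y < x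
  <-asym h h′ = irrefl refl (<-trans h h′)

  ≤-<-trans : x ≤ y → y < z → x < z
  ≤-<-trans (inj₁ h) h′    = <-trans h h′
  ≤-<-trans (inj₂ refl) h′ = h′

  <-≤-trans : x < y → y ≤ z → x < z
  <-≤-trans h (inj₁ h′)   = <-trans h h′
  <-≤-trans h (inj₂ refl) = h

  +-monoʳ-< : ∀ z → x < y → z + x < z + y
  +-monoʳ-< {x} {y} z h = subst₂ _<_ (+-comm x z) (+-comm y z) (+-monoˡ-< z h)

  +-cancelʳ-< : ∀ z → x + z < y + z → x < y
  +-cancelʳ-< {x} {y} z h =
    subst₂ _<_ (//-rightDividesʳ z x) (//-rightDividesʳ z y) (+-monoˡ-< (- z) h)

  +-monoˡ-≤ : ∀ z → x ≤ y → (x + z) ≤ (y + z)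
  +-monoˡ-≤ z (inj₁ h)    = inj₁ (+-monoˡ-< z h)
  +-monoˡ-≤ z (inj₂ refl) = ≤-refl

  +-monoʳ-≤ : ∀ z → x ≤ y → (z + x) ≤ (z + y)
  +-monoʳ-≤ z (inj₁ h)    = inj₁ (+-monoʳ-< z h)
  +-monoʳ-≤ z (inj₂ refl) = ≤-refl

  +-mono-<-≤ : x < x′ → y ≤ y′ → x + y < x′ + y′
  +-mono-<-≤ h h′ = <-≤-trans (+-monoˡ-< _ h) (+-monoʳ-≤ _ h′)

  +-mono-≤-< : x ≤ x′ → y < y′ → x + y < x′ + y′
  +-mono-≤-< h h′ = ≤-<-trans (+-monoˡ-≤ _ h) (+-monoʳ-< _ h′)

  +-mono-≤ : x ≤ x′ → y ≤ y′ → (x + y) ≤ (x′ + y′)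
  +-mono-≤ (inj₁ h)    h′ = inj₁ (+-mono-<-≤ h h′)
  +-mono-≤ (inj₂ refl) h′ = +-monoʳ-≤ _ h′

  neg-anti-< : x < y → - y < - x
  neg-anti-< {x} {y} h = subst₂ _<_ (\\-leftDividesˡ x (- y)) (y+[-x+-y]≡-x x y)
    (+-monoˡ-< (- x + - y) h)

  neg-anti-≤ : x ≤ y → (- y) ≤ (- x)
  neg-anti-≤ (inj₁ h)    = inj₁ (neg-anti-< h)
  neg-anti-≤ (inj₂ refl) = ≤-refl

  sub-mono-<-≤ : x < x′ → y′ ≤ y → x - y < x′ - y′
  sub-mono-<-≤ h h′ = +-mono-<-≤ h (neg-anti-≤ h′)

  sub-mono-≤-< : x ≤ x′ → y′ < y → x - y < x′ - y′
  sub-mono-≤-< h h′ = +-mono-≤-< h (neg-anti-< h′)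

  sub-mono-≤ : x ≤ x′ → y′ ≤ y → (x - y) ≤ (x′ - y′)
  sub-mono-≤ h h′ = +-mono-≤ h (neg-anti-≤ h′)

  <-+1r : x < x + 1r
  <-+1r {x} = subst (_< x + 1r) (+-identityʳ x) (+-monoʳ-< x 0<1)

  -1r-< : x - 1r < x
  -1r-< {x} = subst (x - 1r <_) (//-rightDividesˡ 1r x) <-+1r

  x-y≡x′-y′⇒x≤x′⇒y≤y′ : x - y ≡ x′ - y′ → x ≤ x′ → y ≤ y′
  x-y≡x′-y′⇒x≤x′⇒y≤y′ {y = y} {y′ = y′} e h with compare y y′
  ... | tri< y<y′ _ _ = inj₁ y<y′
  ... | tri≈ _ y≡y′ _ = inj₂ y≡y′
  ... | tri> _ _ y′<y = ⊥-elim (<⇒≢ (sub-mono-≤-< h y′<y) e)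

  x-y≡x′-y′⇒x<x′⇒y<y′ : x - y ≡ x′ - y′ → x < x′ → y < y′
  x-y≡x′-y′⇒x<x′⇒y<y′ {y = y} {y′ = y′} e h with compare y y′
  ... | tri< y<y′ _ _ = y<y′
  ... | tri≈ _ y≡y′ _ = ⊥-elim (<⇒≢ (sub-mono-<-≤ h (inj₂ (sym y≡y′))) e)
  ... | tri> _ _ y′<y = ⊥-elim (<⇒≢ (sub-mono-<-≤ h (inj₁ y′<y)) e)

  a+x≡c⇒x≡c-a : a + x ≡ c → x ≡ c - a
  a+x≡c⇒x≡c-a {a} {x} e = trans (sym (a+x-a≡x a x)) (cong (_- a) e)

  x≡c-a⇒a+x≡c : x ≡ c - a → a + x ≡ c
  x≡c-a⇒a+x≡c {x} {c} {a} e = trans (cong (a +_) e) (a+[c-a]≡c a c)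

  a+x≤c⇒x≤c-a : (a + x) ≤ c → x ≤ (c - a)
  a+x≤c⇒x≤c-a {a} {x} h = subst (_≤ _) (a+x-a≡x a x) (+-monoˡ-≤ (- a) h)

  x≤c-a⇒a+x≤c : x ≤ (c - a) → (a + x) ≤ c
  x≤c-a⇒a+x≤c {x} {c} {a} h = subst (_ ≤_) (a+[c-a]≡c a c) (+-monoʳ-≤ a h)

  c≤a+x⇒c-a≤x : c ≤ (a + x) → (c - a) ≤ x
  c≤a+x⇒c-a≤x {c} {a} {x} h = subst (_ ≤_) (a+x-a≡x a x) (+-monoˡ-≤ (- a) h)

  c-a≤x⇒c≤a+x : (c - a) ≤ x → c ≤ (a + x)
  c-a≤x⇒c≤a+x {c} {a} {x} h = subst (_≤ _) (a+[c-a]≡c a c) (+-monoʳ-≤ a h)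

  data Ray : Set where
    northEast south west : Ray

  variable
    r r′ : Ray
    p q v v′ w m : Point
    u u′ : Line

  OnRay : Ray → Point → Point → Set
  OnRay northEast (v₁ , v₂) (p₁ , p₂) = p₁ - p₂ ≡ v₁ - v₂ × v₁ ≤ p₁
  OnRay south     (v₁ , v₂) (p₁ , p₂) = p₁ ≡ v₁ × p₂ ≤ v₂
  OnRay west      (v₁ , v₂) (p₁ , p₂) = p₂ ≡ v₂ × p₁ ≤ v₁

  OnOpenRay : Ray → Point → Point → Set
  OnOpenRay northEast (v₁ , v₂) (p₁ , p₂) = p₁ - p₂ ≡ v₁ - v₂ × v₁ < p₁
  OnOpenRay south     (v₁ , v₂) (p₁ , p₂) = p₁ ≡ v₁ × p₂ < v₂
  OnOpenRay west      (v₁ , v₂) (p₁ , p₂) = p₂ ≡ v₂ × p₁ < v₁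

  OnOpenRay⇒OnRay : ∀ r → OnOpenRay r v p → OnRay r v p
  OnOpenRay⇒OnRay northEast (e , h) = e , inj₁ h
  OnOpenRay⇒OnRay south     (e , h) = e , inj₁ h
  OnOpenRay⇒OnRay west      (e , h) = e , inj₁ h

  OnLineAt : Point → Point → Set
  OnLineAt v p = Σ Ray λ r → OnRay r v p

  -- The point where u₁ + x, u₂ + y and u₃ all coincide.
  vertex : Line → Point
  vertex (u₁ , u₂ , u₃) = (u₃ - u₁ , u₃ - u₂)

  lineAt : Point → Line
  lineAt (v₁ , v₂) = (- v₁ , - v₂ , 0r)

  vertex-lineAt : ∀ v → vertex (lineAt v) ≡ v
  vertex-lineAt (v₁ , v₂) = cong₂ _,_ (0-[-x]≡x v₁) (0-[-x]≡x v₂)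
    where
    0-[-x]≡x : ∀ x → 0r - (- x) ≡ x
    0-[-x]≡x x = trans (+-identityˡ (- (- x))) (⁻¹-involutive x)

  MaxTwice⇒OnLineAt : ∀ u₁ u₂ u₃ → MaxTwice (u₁ + x) (u₂ + y) u₃ →
                      OnLineAt (u₃ - u₁ , u₃ - u₂) (x , y)
  MaxTwice⇒OnLineAt u₁ u₂ u₃ (inj₁ (e , h)) =
    northEast , trans (a+x≡b+y⇒x-y≡b-a e) (sym ([c-a]-[c-b]≡b-a u₁ u₂ u₃)) , c≤a+x⇒c-a≤x h
  MaxTwice⇒OnLineAt u₁ u₂ u₃ (inj₂ (inj₁ (e , h))) =
    south , a+x≡c⇒x≡c-a e , a+x≤c⇒x≤c-a (subst (_ ≤_) e h)
  MaxTwice⇒OnLineAt u₁ u₂ u₃ (inj₂ (inj₂ (e , h))) =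
    west , a+x≡c⇒x≡c-a e , a+x≤c⇒x≤c-a (subst (_ ≤_) e h)

  OnLineAt⇒MaxTwice : ∀ u₁ u₂ u₃ → OnLineAt (u₃ - u₁ , u₃ - u₂) (x , y) →
                      MaxTwice (u₁ + x) (u₂ + y) u₃
  OnLineAt⇒MaxTwice u₁ u₂ u₃ (northEast , e , h) =
    inj₁ (x-y≡b-a⇒a+x≡b+y (trans e ([c-a]-[c-b]≡b-a u₁ u₂ u₃)) , c-a≤x⇒c≤a+x h)
  OnLineAt⇒MaxTwice u₁ u₂ u₃ (south , e , h) =
    inj₂ (inj₁ (x≡c-a⇒a+x≡c e , subst (_ ≤_) (sym (x≡c-a⇒a+x≡c e)) (x≤c-a⇒a+x≤c h)))
  OnLineAt⇒MaxTwice u₁ u₂ u₃ (west , e , h) =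
    inj₂ (inj₂ (x≡c-a⇒a+x≡c e , subst (_ ≤_) (sym (x≡c-a⇒a+x≡c e)) (x≤c-a⇒a+x≤c h)))

  OnLine⇒OnLineAt : ∀ u → OnLine u p → OnLineAt (vertex u) p
  OnLine⇒OnLineAt (u₁ , u₂ , u₃) h =
    MaxTwice⇒OnLineAt u₁ u₂ u₃ (subst (MaxTwice _ _) (+-identityʳ u₃) h)

  OnLineAt⇒OnLine : ∀ u → OnLineAt (vertex u) p → OnLine u p
  OnLineAt⇒OnLine (u₁ , u₂ , u₃) h =
    subst (MaxTwice _ _) (sym (+-identityʳ u₃)) (OnLineAt⇒MaxTwice u₁ u₂ u₃ h)

  OnLineAt⇒OnLine-lineAt : OnLineAt v p → OnLine (lineAt v) p
  OnLineAt⇒OnLine-lineAt {v} {p} h =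
    OnLineAt⇒OnLine (lineAt v) (subst (λ w → OnLineAt w p) (sym (vertex-lineAt v)) h)

  northEast-y : OnRay northEast (v₁ , v₂) (p₁ , p₂) → v₂ ≤ p₂
  northEast-y (e , h) = x-y≡x′-y′⇒x≤x′⇒y≤y′ (sym e) h

  south-diag : OnRay south (v₁ , v₂) (p₁ , p₂) → (v₁ - v₂) ≤ (p₁ - p₂)
  south-diag (e , h) = sub-mono-≤ (inj₂ (sym e)) h

  west-diag : OnRay west (v₁ , v₂) (p₁ , p₂) → (p₁ - p₂) ≤ (v₁ - v₂)
  west-diag (e , h) = sub-mono-≤ h (inj₂ (sym e))

  ≡-from-x-diag : x ≡ x′ → x - y ≡ x′ - y′ → (x , y) ≡ (x′ , y′)
  ≡-from-x-diag refl e = cong (_ ,_) (x-y≡x-y′⇒y≡y′ e)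

  ≡-from-y-diag : y ≡ y′ → x - y ≡ x′ - y′ → (x , y) ≡ (x′ , y′)
  ≡-from-y-diag refl e = cong (_, _) (x-y≡x′-y⇒x≡x′ e)

  OnLineAt-antisym : OnLineAt w v → OnLineAt v w → v ≡ w
  OnLineAt-antisym (northEast , hv) (northEast , hw) =
    ≡-from-x-diag (≤-antisym (proj₂ hw) (proj₂ hv)) (proj₁ hv)
  OnLineAt-antisym (northEast , hv) (south , hw) = ≡-from-x-diag (sym (proj₁ hw)) (proj₁ hv)
  OnLineAt-antisym (northEast , hv) (west  , hw) = ≡-from-y-diag (sym (proj₁ hw)) (proj₁ hv)
  OnLineAt-antisym (south , hv) (northEast , hw) = ≡-from-x-diag (proj₁ hv) (sym (proj₁ hw))
  OnLineAt-antisym (south , hv) (south , hw) = cong₂ _,_ (proj₁ hv) (≤-antisym (proj₂ hv) (proj₂ hw))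
  OnLineAt-antisym (south , hv) (west  , hw) = cong₂ _,_ (proj₁ hv) (sym (proj₁ hw))
  OnLineAt-antisym (west  , hv) (northEast , hw) = ≡-from-y-diag (proj₁ hv) (sym (proj₁ hw))
  OnLineAt-antisym (west  , hv) (south , hw) = cong₂ _,_ (sym (proj₁ hw)) (proj₁ hv)
  OnLineAt-antisym (west  , hv) (west  , hw) = cong₂ _,_ (≤-antisym (proj₂ hv) (proj₂ hw)) (proj₁ hv)

  vertex-OnLine : ∀ u → OnLine u (vertex u)
  vertex-OnLine u = OnLineAt⇒OnLine u (northEast , refl , ≤-refl)

  SameLine⇒vertex≡ : ∀ u u′ → SameLine u u′ → vertex u ≡ vertex u′
  SameLine⇒vertex≡ u u′ same = OnLineAt-antisym
    (OnLine⇒OnLineAt u′ (proj₁ (same (vertex u)) (vertex-OnLine u)))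
    (OnLine⇒OnLineAt u (proj₂ (same (vertex u′)) (vertex-OnLine u′)))

  vertex≡⇒SameLine : ∀ u u′ → vertex u ≡ vertex u′ → SameLine u u′
  vertex≡⇒SameLine u u′ e z =
    (λ h → OnLineAt⇒OnLine u′ (subst (λ v → OnLineAt v z) e (OnLine⇒OnLineAt u h))) ,
    (λ h → OnLineAt⇒OnLine u (subst (λ v → OnLineAt v z) (sym e) (OnLine⇒OnLineAt u′ h)))

  step : Ray → Point → Point
  step northEast (x , y) = (x + 1r , y + 1r)
  step south     (x , y) = (x , y - 1r)
  step west      (x , y) = (x - 1r , y)

  unstep : Ray → Point → Point
  unstep northEast (x , y) = (x - 1r , y - 1r)
  unstep south     (x , y) = (x , y + 1r)
  unstep west      (x , y) = (x + 1r , y)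

  step-≢ : ∀ r p → step r p ≢ p
  step-≢ northEast _ e = <⇒≢ <-+1r (sym (cong proj₁ e))
  step-≢ south     _ e = <⇒≢ -1r-< (cong proj₂ e)
  step-≢ west      _ e = <⇒≢ -1r-< (cong proj₁ e)

  unstep-≢ : ∀ r v → unstep r v ≢ v
  unstep-≢ northEast _ e = <⇒≢ -1r-< (cong proj₁ e)
  unstep-≢ south     _ e = <⇒≢ <-+1r (sym (cong proj₂ e))
  unstep-≢ west      _ e = <⇒≢ <-+1r (sym (cong proj₁ e))

  OnRay-step : ∀ r → OnRay r v p → OnRay r v (step r p)
  OnRay-step northEast (e , h) = trans ([x+k]-[y+k]≡x-y _ _ 1r) e , inj₁ (≤-<-trans h <-+1r)
  OnRay-step south     (e , h) = e , inj₁ (<-≤-trans -1r-< h)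
  OnRay-step west      (e , h) = e , inj₁ (<-≤-trans -1r-< h)

  OnRay-unstep : ∀ r → OnRay r v p → OnRay r (unstep r v) p
  OnRay-unstep northEast (e , h) =
    trans e (sym ([x+k]-[y+k]≡x-y _ _ (- 1r))) , inj₁ (<-≤-trans -1r-< h)
  OnRay-unstep south     (e , h) = e , inj₁ (≤-<-trans h <-+1r)
  OnRay-unstep west      (e , h) = e , inj₁ (≤-<-trans h <-+1r)

  sharedRay⇒¬TransversalPts : ∀ r v → OnRay r v p → OnRay r v q → ¬ TransversalPts p q
  sharedRay⇒¬TransversalPts {p} {q} r v hp hq (u , _ , _ , unique) =
    unstep-≢ r v (trans (vertex-through (OnRay-unstep r hp) (OnRay-unstep r hq))
                        (sym (vertex-through hp hq)))
    where
    vertex-through : ∀ {w} → OnRay r w p → OnRay r w q → w ≡ vertex u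
    vertex-through {w} hp hq = trans (sym (vertex-lineAt w)) (SameLine⇒vertex≡ (lineAt w) u
      (unique (lineAt w) (OnLineAt⇒OnLine-lineAt (r , hp)) (OnLineAt⇒OnLine-lineAt (r , hq))))

  sharedRay⇒¬TransversalLines : ∀ r u u′ → OnRay r (vertex u) w → OnRay r (vertex u′) w →
                                ¬ TransversalLines u u′
  sharedRay⇒¬TransversalLines {w} r u u′ h h′ (z₀ , _ , _ , unique) =
    step-≢ r w (trans (meet (OnRay-step r h) (OnRay-step r h′)) (sym (meet h h′)))
    where
    meet : ∀ {z} → OnRay r (vertex u) z → OnRay r (vertex u′) z → z ≡ z₀
    meet h h′ = unique _ (OnLineAt⇒OnLine u (r , h)) (OnLineAt⇒OnLine u′ (r , h′))

  module _ {p₁ p₂ q₁ q₂ v₁ v₂ : ℝ} where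

    left-on-south : p₁ < q₁ → q₁ - q₂ < p₁ - p₂ →
                    OnLineAt (v₁ , v₂) (p₁ , p₂) → OnLineAt (v₁ , v₂) (q₁ , q₂) →
                    OnRay south (v₁ , v₂) (p₁ , p₂)
    left-on-south _ _ (south , hp) _ = hp
    left-on-south _ d (northEast , hp) (northEast , hq) = begin-contradiction
      q₁ - q₂  <⟨ d ⟩  p₁ - p₂  ≡⟨ proj₁ hp ⟩
      v₁ - v₂  ≡⟨ proj₁ hq ⟨  q₁ - q₂  ∎
    left-on-south _ d (northEast , hp) (south , hq) = begin-contradiction
      q₁ - q₂  <⟨ d ⟩  p₁ - p₂  ≡⟨ proj₁ hp ⟩
      v₁ - v₂  ≤⟨ south-diag hq ⟩  q₁ - q₂  ∎
    left-on-south l _ (northEast , hp) (west , hq) = begin-contradiction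
      p₁  <⟨ l ⟩  q₁  ≤⟨ proj₂ hq ⟩  v₁  ≤⟨ proj₂ hp ⟩  p₁  ∎
    left-on-south _ d (west , hp) (northEast , hq) = begin-contradiction
      q₁ - q₂  <⟨ d ⟩  p₁ - p₂  ≤⟨ west-diag hp ⟩
      v₁ - v₂  ≡⟨ proj₁ hq ⟨  q₁ - q₂  ∎
    left-on-south _ d (west , hp) (south , hq) = begin-contradiction
      q₁ - q₂  <⟨ d ⟩  p₁ - p₂  ≤⟨ west-diag hp ⟩
      v₁ - v₂  ≤⟨ south-diag hq ⟩  q₁ - q₂  ∎
    left-on-south l d (west , hp) (west , hq) = begin-contradiction
      q₁ - q₂  <⟨ d ⟩
      p₁ - p₂  <⟨ sub-mono-<-≤ l (inj₂ (trans (proj₁ hq) (sym (proj₁ hp)))) ⟩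
      q₁ - q₂  ∎

    left-on-west : p₁ < q₁ → p₁ - p₂ < q₁ - q₂ →
                   OnLineAt (v₁ , v₂) (p₁ , p₂) → OnLineAt (v₁ , v₂) (q₁ , q₂) →
                   OnRay west (v₁ , v₂) (p₁ , p₂)
    left-on-west _ _ (west , hp) _ = hp
    left-on-west _ d (northEast , hp) (northEast , hq) = begin-contradiction
      p₁ - p₂  <⟨ d ⟩  q₁ - q₂  ≡⟨ proj₁ hq ⟩
      v₁ - v₂  ≡⟨ proj₁ hp ⟨  p₁ - p₂  ∎
    left-on-west l _ (northEast , hp) (south , hq) = begin-contradiction
      p₁  <⟨ l ⟩  q₁  ≡⟨ proj₁ hq ⟩  v₁  ≤⟨ proj₂ hp ⟩  p₁  ∎
    left-on-west l _ (northEast , hp) (west , hq) = begin-contradiction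
      p₁  <⟨ l ⟩  q₁  ≤⟨ proj₂ hq ⟩  v₁  ≤⟨ proj₂ hp ⟩  p₁  ∎
    left-on-west _ d (south , hp) (northEast , hq) = begin-contradiction
      p₁ - p₂  <⟨ d ⟩  q₁ - q₂  ≡⟨ proj₁ hq ⟩
      v₁ - v₂  ≤⟨ south-diag hp ⟩  p₁ - p₂  ∎
    left-on-west l _ (south , hp) (south , hq) = begin-contradiction
      p₁  <⟨ l ⟩  q₁  ≡⟨ proj₁ hq ⟩  v₁  ≡⟨ proj₁ hp ⟨  p₁  ∎
    left-on-west l _ (south , hp) (west , hq) = begin-contradiction
      p₁  <⟨ l ⟩  q₁  ≤⟨ proj₂ hq ⟩  v₁  ≡⟨ proj₁ hp ⟨  p₁  ∎

    right-on-south : p₁ < q₁ → q₂ < p₂ →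
                     OnLineAt (v₁ , v₂) (p₁ , p₂) → OnLineAt (v₁ , v₂) (q₁ , q₂) →
                     OnRay south (v₁ , v₂) (q₁ , q₂)
    right-on-south _ _ _ (south , hq) = hq
    right-on-south l d (northEast , hp) (northEast , hq) = begin-contradiction
      p₁ - p₂  <⟨ sub-mono-<-≤ l (inj₁ d) ⟩
      q₁ - q₂  ≡⟨ proj₁ hq ⟩  v₁ - v₂  ≡⟨ proj₁ hp ⟨  p₁ - p₂  ∎
    right-on-south l d (south , hp) (northEast , hq) = begin-contradiction
      p₁ - p₂  <⟨ sub-mono-<-≤ l (inj₁ d) ⟩
      q₁ - q₂  ≡⟨ proj₁ hq ⟩  v₁ - v₂  ≤⟨ south-diag hp ⟩  p₁ - p₂  ∎
    right-on-south _ d (west , hp) (northEast , hq) = begin-contradiction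
      q₂  <⟨ d ⟩  p₂  ≡⟨ proj₁ hp ⟩  v₂  ≤⟨ northEast-y hq ⟩  q₂  ∎
    right-on-south l _ (northEast , hp) (west , hq) = begin-contradiction
      p₁  <⟨ l ⟩  q₁  ≤⟨ proj₂ hq ⟩  v₁  ≤⟨ proj₂ hp ⟩  p₁  ∎
    right-on-south l _ (south , hp) (west , hq) = begin-contradiction
      p₁  <⟨ l ⟩  q₁  ≤⟨ proj₂ hq ⟩  v₁  ≡⟨ proj₁ hp ⟨  p₁  ∎
    right-on-south _ d (west , hp) (west , hq) = begin-contradiction
      q₂  <⟨ d ⟩  p₂  ≡⟨ proj₁ hp ⟩  v₂  ≡⟨ proj₁ hq ⟨  q₂  ∎

    right-on-northEast : p₁ < q₁ → p₂ < q₂ →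
                         OnLineAt (v₁ , v₂) (p₁ , p₂) → OnLineAt (v₁ , v₂) (q₁ , q₂) →
                         OnRay northEast (v₁ , v₂) (q₁ , q₂)
    right-on-northEast _ _ _ (northEast , hq) = hq
    right-on-northEast l _ (northEast , hp) (south , hq) = begin-contradiction
      p₁  <⟨ l ⟩  q₁  ≡⟨ proj₁ hq ⟩  v₁  ≤⟨ proj₂ hp ⟩  p₁  ∎
    right-on-northEast l _ (south , hp) (south , hq) = begin-contradiction
      p₁  <⟨ l ⟩  q₁  ≡⟨ proj₁ hq ⟩  v₁  ≡⟨ proj₁ hp ⟨  p₁  ∎
    right-on-northEast _ d (west , hp) (south , hq) = begin-contradiction
      p₂  <⟨ d ⟩  q₂  ≤⟨ proj₂ hq ⟩  v₂  ≡⟨ proj₁ hp ⟨  p₂  ∎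
    right-on-northEast l _ (northEast , hp) (west , hq) = begin-contradiction
      p₁  <⟨ l ⟩  q₁  ≤⟨ proj₂ hq ⟩  v₁  ≤⟨ proj₂ hp ⟩  p₁  ∎
    right-on-northEast l _ (south , hp) (west , hq) = begin-contradiction
      p₁  <⟨ l ⟩  q₁  ≤⟨ proj₂ hq ⟩  v₁  ≡⟨ proj₁ hp ⟨  p₁  ∎
    right-on-northEast _ d (west , hp) (west , hq) = begin-contradiction
      p₂  <⟨ d ⟩  q₂  ≡⟨ proj₁ hq ⟩  v₂  ≡⟨ proj₁ hp ⟨  p₂  ∎

  TransversalPts-sym : TransversalPts p q → TransversalPts q p
  TransversalPts-sym (u , hp , hq , unique) = u , hq , hp , λ v hq′ hp′ → unique v hp′ hq′

  TransversalLines-sym : TransversalLines u u′ → TransversalLines u′ u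
  TransversalLines-sym (z , hu , hu′ , unique) = z , hu′ , hu , λ w h′ h → unique w h h′

  TransversalPts⇒x≢ : TransversalPts (p₁ , p₂) (q₁ , q₂) → p₁ ≢ q₁
  TransversalPts⇒x≢ {p₁} {p₂} {q₁} {q₂} t e with ≤-total p₂ q₂
  ... | inj₁ h = sharedRay⇒¬TransversalPts south (q₁ , q₂) (e , h) (refl , ≤-refl) t
  ... | inj₂ h = sharedRay⇒¬TransversalPts south (p₁ , p₂) (refl , ≤-refl) (sym e , h) t

  TransversalPts⇒y≢ : TransversalPts (p₁ , p₂) (q₁ , q₂) → p₂ ≢ q₂
  TransversalPts⇒y≢ {p₁} {p₂} {q₁} {q₂} t e with ≤-total p₁ q₁
  ... | inj₁ h = sharedRay⇒¬TransversalPts west (q₁ , q₂) (e , h) (refl , ≤-refl) t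
  ... | inj₂ h = sharedRay⇒¬TransversalPts west (p₁ , p₂) (refl , ≤-refl) (sym e , h) t

  TransversalPts⇒diag≢ : TransversalPts (p₁ , p₂) (q₁ , q₂) → p₁ - p₂ ≢ q₁ - q₂
  TransversalPts⇒diag≢ {p₁} {p₂} {q₁} {q₂} t e with ≤-total p₁ q₁
  ... | inj₁ h = sharedRay⇒¬TransversalPts northEast (p₁ , p₂) (refl , ≤-refl) (sym e , h) t
  ... | inj₂ h = sharedRay⇒¬TransversalPts northEast (q₁ , q₂) (e , h) (refl , ≤-refl) t

  vertex-from-open-rays : ∀ r r′ {v₁ v₂ m₁ m₂ p₁ p₂ q₁ q₂} → r ≢ r′ →
    OnOpenRay r (m₁ , m₂) (p₁ , p₂) → OnOpenRay r′ (m₁ , m₂) (q₁ , q₂) →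
    OnLineAt (v₁ , v₂) (p₁ , p₂) → OnLineAt (v₁ , v₂) (q₁ , q₂) →
    (v₁ , v₂) ≡ (m₁ , m₂)
  vertex-from-open-rays south northEast {v₁} {v₂} {m₁} {m₂} {p₁} {p₂} {q₁} {q₂}
                        _ (p₁≡m₁ , p₂<m₂) (dq≡dm , m₁<q₁) lp lq =
    ≡-from-x-diag (trans (sym p₁≡v₁) p₁≡m₁) (trans (sym dq≡dv) dq≡dm)
    where
    p₁<q₁ : p₁ < q₁
    p₁<q₁ = subst (_< q₁) (sym p₁≡m₁) m₁<q₁
    dq<dp : q₁ - q₂ < p₁ - p₂
    dq<dp = begin-strict
      q₁ - q₂  ≡⟨ dq≡dm ⟩
      m₁ - m₂  <⟨ sub-mono-≤-< (inj₂ (sym p₁≡m₁)) p₂<m₂ ⟩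
      p₁ - p₂  ∎
    p₂<q₂ : p₂ < q₂
    p₂<q₂ = <-trans p₂<m₂ (x-y≡x′-y′⇒x<x′⇒y<y′ (sym dq≡dm) m₁<q₁)
    p₁≡v₁ : p₁ ≡ v₁
    p₁≡v₁ = proj₁ (left-on-south p₁<q₁ dq<dp lp lq)
    dq≡dv : q₁ - q₂ ≡ v₁ - v₂
    dq≡dv = proj₁ (right-on-northEast p₁<q₁ p₂<q₂ lp lq)
  vertex-from-open-rays west northEast {v₁} {v₂} {m₁} {m₂} {p₁} {p₂} {q₁} {q₂}
                        _ (p₂≡m₂ , p₁<m₁) (dq≡dm , m₁<q₁) lp lq =
    ≡-from-y-diag (trans (sym p₂≡v₂) p₂≡m₂) (trans (sym dq≡dv) dq≡dm)
    where
    p₁<q₁ : p₁ < q₁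
    p₁<q₁ = <-trans p₁<m₁ m₁<q₁
    dp<dq : p₁ - p₂ < q₁ - q₂
    dp<dq = begin-strict
      p₁ - p₂  <⟨ sub-mono-<-≤ p₁<m₁ (inj₂ (sym p₂≡m₂)) ⟩
      m₁ - m₂  ≡⟨ dq≡dm ⟨
      q₁ - q₂  ∎
    p₂<q₂ : p₂ < q₂
    p₂<q₂ = subst (_< q₂) (sym p₂≡m₂) (x-y≡x′-y′⇒x<x′⇒y<y′ (sym dq≡dm) m₁<q₁)
    p₂≡v₂ : p₂ ≡ v₂
    p₂≡v₂ = proj₁ (left-on-west p₁<q₁ dp<dq lp lq)
    dq≡dv : q₁ - q₂ ≡ v₁ - v₂
    dq≡dv = proj₁ (right-on-northEast p₁<q₁ p₂<q₂ lp lq)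
  vertex-from-open-rays west south {v₁} {v₂} {m₁} {m₂} {p₁} {p₂} {q₁} {q₂}
                        _ (p₂≡m₂ , p₁<m₁) (q₁≡m₁ , q₂<m₂) lp lq =
    cong₂ _,_ (trans (sym q₁≡v₁) q₁≡m₁) (trans (sym p₂≡v₂) p₂≡m₂)
    where
    p₁<q₁ : p₁ < q₁
    p₁<q₁ = subst (p₁ <_) (sym q₁≡m₁) p₁<m₁
    q₂<p₂ : q₂ < p₂
    q₂<p₂ = subst (q₂ <_) (sym p₂≡m₂) q₂<m₂
    p₂≡v₂ : p₂ ≡ v₂
    p₂≡v₂ = proj₁ (left-on-west p₁<q₁ (sub-mono-<-≤ p₁<q₁ (inj₁ q₂<p₂)) lp lq)
    q₁≡v₁ : q₁ ≡ v₁
    q₁≡v₁ = proj₁ (right-on-south p₁<q₁ q₂<p₂ lp lq)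
  vertex-from-open-rays northEast south _ hp hq lp lq =
    vertex-from-open-rays south northEast (λ ()) hq hp lq lp
  vertex-from-open-rays northEast west _ hp hq lp lq =
    vertex-from-open-rays west northEast (λ ()) hq hp lq lp
  vertex-from-open-rays south west _ hp hq lp lq =
    vertex-from-open-rays west south (λ ()) hq hp lq lp
  vertex-from-open-rays northEast northEast r≢r′ _ _ _ _ = ⊥-elim (r≢r′ refl)
  vertex-from-open-rays south     south     r≢r′ _ _ _ _ = ⊥-elim (r≢r′ refl)
  vertex-from-open-rays west      west      r≢r′ _ _ _ _ = ⊥-elim (r≢r′ refl)

  openRays⇒TransversalPts : ∀ r r′ → r ≢ r′ → OnOpenRay r m p → OnOpenRay r′ m q →
                            TransversalPts p q
  openRays⇒TransversalPts {m} {p} {q} r r′ r≢r′ hp hq = lineAt m , on r hp , on r′ hq , unique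
    where
    on : ∀ r {p} → OnOpenRay r m p → OnLine (lineAt m) p
    on r h = OnLineAt⇒OnLine-lineAt (r , OnOpenRay⇒OnRay r h)
    unique : ∀ u → OnLine u p → OnLine u q → SameLine u (lineAt m)
    unique u up uq = vertex≡⇒SameLine u (lineAt m) (trans
      (vertex-from-open-rays r r′ r≢r′ hp hq (OnLine⇒OnLineAt u up) (OnLine⇒OnLineAt u uq))
      (sym (vertex-lineAt m)))

  -ₚ_ : Point → Point
  -ₚ (x , y) = (- x , - y)

  -ₚ-involutive : ∀ p → -ₚ (-ₚ p) ≡ p
  -ₚ-involutive (x , y) = cong₂ _,_ (⁻¹-involutive x) (⁻¹-involutive y)

  neg-diag : p₁ - p₂ ≡ v₁ - v₂ → (- v₁) - (- v₂) ≡ (- p₁) - (- p₂)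
  neg-diag {p₁} {p₂} {v₁} {v₂} e =
    trans (-x-[-y]≡-[x-y] v₁ v₂) (trans (cong -_ (sym e)) (sym (-x-[-y]≡-[x-y] p₁ p₂)))

  OnRay-dual : ∀ r → OnRay r v p → OnRay r (-ₚ p) (-ₚ v)
  OnRay-dual northEast (e , h) = neg-diag e , neg-anti-≤ h
  OnRay-dual south     (e , h) = cong -_ (sym e) , neg-anti-≤ h
  OnRay-dual west      (e , h) = cong -_ (sym e) , neg-anti-≤ h

  OnOpenRay-dual : ∀ r → OnOpenRay r v p → OnOpenRay r (-ₚ p) (-ₚ v)
  OnOpenRay-dual northEast (e , h) = neg-diag e , neg-anti-< h
  OnOpenRay-dual south     (e , h) = cong -_ (sym e) , neg-anti-< h
  OnOpenRay-dual west      (e , h) = cong -_ (sym e) , neg-anti-< h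

  OnLineAt-dual : OnLineAt v p → OnLineAt (-ₚ p) (-ₚ v)
  OnLineAt-dual (r , h) = r , OnRay-dual r h

  dualTransversal⇒TransversalLines : ∀ u u′ →
    TransversalPts (-ₚ vertex u) (-ₚ vertex u′) → TransversalLines u u′
  dualTransversal⇒TransversalLines u u′ (m , hu , hu′ , unique) =
    -ₚ vertex m , meets u hu , meets u′ hu′ , only
    where
    meets : ∀ u → OnLine m (-ₚ vertex u) → OnLine u (-ₚ vertex m)
    meets u h = OnLineAt⇒OnLine u (subst (λ v → OnLineAt v (-ₚ vertex m)) (-ₚ-involutive (vertex u))
                                         (OnLineAt-dual (OnLine⇒OnLineAt m h)))
    only : ∀ w → OnLine u w → OnLine u′ w → w ≡ -ₚ vertex m
    only w h h′ = trans (sym (-ₚ-involutive w)) (cong -ₚ_ (trans (sym (vertex-lineAt (-ₚ w)))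
      (SameLine⇒vertex≡ (lineAt (-ₚ w)) m (unique (lineAt (-ₚ w)) (dual u h) (dual u′ h′)))))
      where
      dual : ∀ u → OnLine u w → OnLine (lineAt (-ₚ w)) (-ₚ vertex u)
      dual u h = OnLineAt⇒OnLine-lineAt (OnLineAt-dual (OnLine⇒OnLineAt u h))

  openRays⇒TransversalLines : ∀ r r′ → r ≢ r′ → OnOpenRay r v p → OnOpenRay r′ v′ p →
                              TransversalLines (lineAt v) (lineAt v′)
  openRays⇒TransversalLines {v} {p} {v′} r r′ r≢r′ h h′ =
    dualTransversal⇒TransversalLines (lineAt v) (lineAt v′)
      (subst₂ (λ w w′ → TransversalPts (-ₚ w) (-ₚ w′))
              (sym (vertex-lineAt v)) (sym (vertex-lineAt v′))
              (openRays⇒TransversalPts r r′ r≢r′ (OnOpenRay-dual r h) (OnOpenRay-dual r′ h′)))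

  Between : ℝ → ℝ → ℝ → Set
  Between x y z = (x < y × y < z) ⊎ (z < y × y < x)

  left-end-between : ∀ u u′ {p₁ p₂ q₁ q₂ q₁′ q₂′} → TransversalLines u u′ →
    OnLine u (p₁ , p₂) → OnLine u (q₁ , q₂) →
    OnLine u′ (p₁ , p₂) → OnLine u′ (q₁′ , q₂′) →
    p₁ < q₁ → p₁ < q₁′ → q₁ - q₂ ≢ p₁ - p₂ → q₁′ - q₂′ ≢ p₁ - p₂ →
    Between (q₁ - q₂) (p₁ - p₂) (q₁′ - q₂′)
  left-end-between u u′ {p₁} {p₂} {q₁} {q₂} {q₁′} {q₂′} tl hp hq hp′ hq′ l l′ d d′
    with compare (q₁ - q₂) (p₁ - p₂) | compare (q₁′ - q₂′) (p₁ - p₂)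
  ... | tri≈ _ e _ | _          = ⊥-elim (d e)
  ... | _          | tri≈ _ e _ = ⊥-elim (d′ e)
  ... | tri< q<p _ _ | tri> _ _ p<q′ = inj₁ (q<p , p<q′)
  ... | tri> _ _ p<q | tri< q′<p _ _ = inj₂ (q′<p , p<q)
  ... | tri< q<p _ _ | tri< q′<p _ _ = ⊥-elim (sharedRay⇒¬TransversalLines south u u′
    (left-on-south l q<p (OnLine⇒OnLineAt u hp) (OnLine⇒OnLineAt u hq))
    (left-on-south l′ q′<p (OnLine⇒OnLineAt u′ hp′) (OnLine⇒OnLineAt u′ hq′)) tl)
  ... | tri> _ _ p<q | tri> _ _ p<q′ = ⊥-elim (sharedRay⇒¬TransversalLines west u u′
    (left-on-west l p<q (OnLine⇒OnLineAt u hp) (OnLine⇒OnLineAt u hq))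
    (left-on-west l′ p<q′ (OnLine⇒OnLineAt u′ hp′) (OnLine⇒OnLineAt u′ hq′)) tl)

  right-end-between : ∀ u u′ {p₁ p₂ q₁ q₂ q₁′ q₂′} → TransversalLines u u′ →
    OnLine u (q₁ , q₂) → OnLine u (p₁ , p₂) →
    OnLine u′ (q₁′ , q₂′) → OnLine u′ (p₁ , p₂) →
    q₁ < p₁ → q₁′ < p₁ → q₂ ≢ p₂ → q₂′ ≢ p₂ → Between q₂ p₂ q₂′
  right-end-between u u′ {p₁} {p₂} {q₁} {q₂} {q₁′} {q₂′} tl hq hp hq′ hp′ l l′ d d′
    with compare q₂ p₂ | compare q₂′ p₂
  ... | tri≈ _ e _ | _          = ⊥-elim (d e)
  ... | _          | tri≈ _ e _ = ⊥-elim (d′ e)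
  ... | tri< q<p _ _ | tri> _ _ p<q′ = inj₁ (q<p , p<q′)
  ... | tri> _ _ p<q | tri< q′<p _ _ = inj₂ (q′<p , p<q)
  ... | tri< q<p _ _ | tri< q′<p _ _ = ⊥-elim (sharedRay⇒¬TransversalLines northEast u u′
    (right-on-northEast l q<p (OnLine⇒OnLineAt u hq) (OnLine⇒OnLineAt u hp))
    (right-on-northEast l′ q′<p (OnLine⇒OnLineAt u′ hq′) (OnLine⇒OnLineAt u′ hp′)) tl)
  ... | tri> _ _ p<q | tri> _ _ p<q′ = ⊥-elim (sharedRay⇒¬TransversalLines south u u′
    (right-on-south l p<q (OnLine⇒OnLineAt u hq) (OnLine⇒OnLineAt u hp))
    (right-on-south l′ p<q′ (OnLine⇒OnLineAt u′ hq′) (OnLine⇒OnLineAt u′ hp′)) tl)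

  betweenness⇒Ineqs : ∀ {a₁ a₂ b₁ b₂ c₁ c₂} → a₁ < b₁ → b₁ < c₁ →
    Between (b₁ - b₂) (a₁ - a₂) (c₁ - c₂) → Between b₂ c₂ a₂ →
    Ineqs (a₁ , a₂) (b₁ , b₂) (c₁ , c₂)
  betweenness⇒Ineqs a<b b<c (inj₁ (db<da , da<dc)) (inj₂ (a₂<c₂ , c₂<b₂)) =
    a<b , b<c , a₂<c₂ , c₂<b₂ , db<da , da<dc
  betweenness⇒Ineqs {a₁} {a₂} {b₁} {b₂} {c₁} {c₂}
                    a<b b<c (inj₂ (dc<da , da<db)) (inj₂ (_ , c₂<b₂)) =
    begin-contradiction
      b₁ - b₂  <⟨ sub-mono-<-≤ b<c (inj₁ c₂<b₂) ⟩
      c₁ - c₂  <⟨ dc<da ⟩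
      a₁ - a₂  <⟨ da<db ⟩
      b₁ - b₂  ∎
  betweenness⇒Ineqs a<b b<c (inj₁ (db<da , _)) (inj₁ (b₂<c₂ , c₂<a₂)) =
    ⊥-elim (<-asym db<da (sub-mono-<-≤ a<b (inj₁ (<-trans b₂<c₂ c₂<a₂))))
  betweenness⇒Ineqs a<b b<c (inj₂ (dc<da , _)) (inj₁ (_ , c₂<a₂)) =
    ⊥-elim (<-asym dc<da (sub-mono-<-≤ (<-trans a<b b<c) (inj₁ c₂<a₂)))

  sorted-TransversalTriangle⇒Ineqs : ∀ {a₁ a₂ b₁ b₂ c₁ c₂} →
    TransversalTriangle (a₁ , a₂) (b₁ , b₂) (c₁ , c₂) → a₁ < b₁ → b₁ < c₁ →
    Ineqs (a₁ , a₂) (b₁ , b₂) (c₁ , c₂)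
  sorted-TransversalTriangle⇒Ineqs
    (_ , _ , _ , _ , tab@(u , au , bu , _) , tbc@(u′ , bu′ , cu′ , _) , tca@(u″ , cu″ , au″ , _) ,
     _ , tl₂ , tl₃) a<b b<c =
    betweenness⇒Ineqs a<b b<c
      (left-end-between u u″ (TransversalLines-sym tl₃) au bu au″ cu″ a<b a<c
        (≢-sym (TransversalPts⇒diag≢ tab)) (TransversalPts⇒diag≢ tca))
      (right-end-between u′ u″ tl₂ bu′ cu′ au″ cu″ b<c a<c
        (TransversalPts⇒y≢ tbc) (≢-sym (TransversalPts⇒y≢ tca)))
    where
    a<c = <-trans a<b b<c

  TransversalTriangle-rotate : ∀ {a b c} → TransversalTriangle a b c → TransversalTriangle b c a
  TransversalTriangle-rotate (a≢b , b≢c , c≢a , noncollinear , tab , tbc , tca , tl₁ , tl₂ , tl₃) =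
    b≢c , c≢a , a≢b , (λ { (u , hb , hc , ha) → noncollinear (u , ha , hb , hc) }) ,
    tbc , tca , tab , tl₂ , tl₃ , tl₁

  TransversalTriangle-swap : ∀ {a b c} → TransversalTriangle a b c → TransversalTriangle b a c
  TransversalTriangle-swap (a≢b , b≢c , c≢a , noncollinear , tab , tbc , tca , tl₁ , tl₂ , tl₃) =
    ≢-sym a≢b , ≢-sym c≢a , ≢-sym b≢c ,
    (λ { (u , hb , ha , hc) → noncollinear (u , ha , hb , hc) }) ,
    TransversalPts-sym tab , TransversalPts-sym tca , TransversalPts-sym tbc ,
    TransversalLines-sym tl₃ , TransversalLines-sym tl₂ , TransversalLines-sym tl₁

  TransversalTriangle⇒IneqsUpToRelabel : ∀ a b c → TransversalTriangle a b c → IneqsUpToRelabel a b c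
  TransversalTriangle⇒IneqsUpToRelabel (a₁ , a₂) (b₁ , b₂) (c₁ , c₂)
                                       t@(_ , _ , _ , _ , tab , tbc , tca , _)
    with compare a₁ b₁ | compare b₁ c₁ | compare a₁ c₁
  ... | tri≈ _ e _ | _ | _ = ⊥-elim (TransversalPts⇒x≢ tab e)
  ... | _ | tri≈ _ e _ | _ = ⊥-elim (TransversalPts⇒x≢ tbc e)
  ... | _ | _ | tri≈ _ e _ = ⊥-elim (TransversalPts⇒x≢ tca (sym e))
  ... | tri< a<b _ _ | tri< b<c _ _ | _ =
    inj₁ (sorted-TransversalTriangle⇒Ineqs t a<b b<c)
  ... | tri< a<b _ _ | tri> _ _ c<b | tri< a<c _ _ =
    inj₂ (inj₁ (sorted-TransversalTriangle⇒Ineqs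
      (TransversalTriangle-rotate (TransversalTriangle-swap t)) a<c c<b))
  ... | tri> _ _ b<a | tri< b<c _ _ | tri< a<c _ _ =
    inj₂ (inj₂ (inj₁ (sorted-TransversalTriangle⇒Ineqs
      (TransversalTriangle-swap t) b<a a<c)))
  ... | tri> _ _ b<a | tri< b<c _ _ | tri> _ _ c<a =
    inj₂ (inj₂ (inj₂ (inj₁ (sorted-TransversalTriangle⇒Ineqs
      (TransversalTriangle-rotate t) b<c c<a))))
  ... | tri< a<b _ _ | tri> _ _ c<b | tri> _ _ c<a =
    inj₂ (inj₂ (inj₂ (inj₂ (inj₁ (sorted-TransversalTriangle⇒Ineqs
      (TransversalTriangle-rotate (TransversalTriangle-rotate t)) c<a a<b)))))
  ... | tri> _ _ b<a | tri> _ _ c<b | _ =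
    inj₂ (inj₂ (inj₂ (inj₂ (inj₂ (sorted-TransversalTriangle⇒Ineqs
      (TransversalTriangle-swap (TransversalTriangle-rotate t)) c<b b<a)))))

  Ineqs⇒TransversalTriangle : ∀ {a₁ a₂ b₁ b₂ c₁ c₂} →
    Ineqs (a₁ , a₂) (b₁ , b₂) (c₁ , c₂) → TransversalTriangle (a₁ , a₂) (b₁ , b₂) (c₁ , c₂)
  Ineqs⇒TransversalTriangle {a₁} {a₂} {b₁} {b₂} {c₁} {c₂}
                            (a<b , b<c , a₂<c₂ , c₂<b₂ , db<da , da<dc) =
    (λ e → <⇒≢ a<b (cong proj₁ e)) , (λ e → <⇒≢ b<c (cong proj₁ e)) ,
    (λ e → <⇒≢ a<c (sym (cong proj₁ e))) , noncollinear , tab , tbc , tca ,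
    openRays⇒TransversalLines northEast west (λ ()) b∈ab b∈bc ,
    openRays⇒TransversalLines south northEast (λ ()) c∈bc c∈ca ,
    openRays⇒TransversalLines west south (λ ()) a∈ca a∈ab
    where
    a<c : a₁ < c₁
    a<c = <-trans a<b b<c
    m-ab m-bc m-ca : Point
    m-ab = (a₁ , a₁ - (b₁ - b₂))
    m-bc = (c₁ , b₂)
    m-ca = (a₂ + (c₁ - c₂) , a₂)
    a∈ab : OnOpenRay south m-ab (a₁ , a₂)
    a∈ab = refl , (begin-strict
      a₂              ≡⟨ x-[x-d]≡d a₁ a₂ ⟨
      a₁ - (a₁ - a₂)  <⟨ sub-mono-≤-< ≤-refl db<da ⟩
      a₁ - (b₁ - b₂)  ∎)
    b∈ab : OnOpenRay northEast m-ab (b₁ , b₂)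
    b∈ab = sym (x-[x-d]≡d a₁ (b₁ - b₂)) , a<b
    b∈bc : OnOpenRay west m-bc (b₁ , b₂)
    b∈bc = refl , b<c
    c∈bc : OnOpenRay south m-bc (c₁ , c₂)
    c∈bc = refl , c₂<b₂
    c∈ca : OnOpenRay northEast m-ca (c₁ , c₂)
    c∈ca = sym (a+x-a≡x a₂ (c₁ - c₂)) , (begin-strict
      a₂ + (c₁ - c₂)  <⟨ +-monoˡ-< (c₁ - c₂) a₂<c₂ ⟩
      c₂ + (c₁ - c₂)  ≡⟨ a+[c-a]≡c c₂ c₁ ⟩
      c₁              ∎)
    a∈ca : OnOpenRay west m-ca (a₁ , a₂)
    a∈ca = refl , (begin-strict
      a₁              ≡⟨ a+[c-a]≡c a₂ a₁ ⟨
      a₂ + (a₁ - a₂)  <⟨ +-monoʳ-< a₂ da<dc ⟩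
      a₂ + (c₁ - c₂)  ∎)
    tab : TransversalPts (a₁ , a₂) (b₁ , b₂)
    tab = openRays⇒TransversalPts south northEast (λ ()) a∈ab b∈ab
    tbc : TransversalPts (b₁ , b₂) (c₁ , c₂)
    tbc = openRays⇒TransversalPts west south (λ ()) b∈bc c∈bc
    tca : TransversalPts (c₁ , c₂) (a₁ , a₂)
    tca = openRays⇒TransversalPts northEast west (λ ()) c∈ca a∈ca
    noncollinear : ¬ Collinear (a₁ , a₂) (b₁ , b₂) (c₁ , c₂)
    noncollinear (u , au , bu , cu) = sharedRay⇒¬TransversalPts northEast (vertex u)
      (right-on-northEast a<b (<-trans a₂<c₂ c₂<b₂) (OnLine⇒OnLineAt u au) (OnLine⇒OnLineAt u bu))
      (right-on-northEast a<c a₂<c₂ (OnLine⇒OnLineAt u au) (OnLine⇒OnLineAt u cu))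
      tbc

  IneqsUpToRelabel⇒TransversalTriangle : ∀ a b c → IneqsUpToRelabel a b c → TransversalTriangle a b c
  IneqsUpToRelabel⇒TransversalTriangle _ _ _ (inj₁ h) =
    Ineqs⇒TransversalTriangle h
  IneqsUpToRelabel⇒TransversalTriangle _ _ _ (inj₂ (inj₁ h)) =
    TransversalTriangle-rotate (TransversalTriangle-swap (Ineqs⇒TransversalTriangle h))
  IneqsUpToRelabel⇒TransversalTriangle _ _ _ (inj₂ (inj₂ (inj₁ h))) =
    TransversalTriangle-swap (Ineqs⇒TransversalTriangle h)
  IneqsUpToRelabel⇒TransversalTriangle _ _ _ (inj₂ (inj₂ (inj₂ (inj₁ h)))) =
    TransversalTriangle-rotate (TransversalTriangle-rotate (Ineqs⇒TransversalTriangle h))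
  IneqsUpToRelabel⇒TransversalTriangle _ _ _ (inj₂ (inj₂ (inj₂ (inj₂ (inj₁ h))))) =
    TransversalTriangle-rotate (Ineqs⇒TransversalTriangle h)
  IneqsUpToRelabel⇒TransversalTriangle _ _ _ (inj₂ (inj₂ (inj₂ (inj₂ (inj₂ h))))) =
    TransversalTriangle-rotate (TransversalTriangle-rotate
      (TransversalTriangle-swap (Ineqs⇒TransversalTriangle h)))

  shift-Ineqs : ∀ l a b c → Ineqs a b c → Ineqs (shift l a) (shift l b) (shift l c)
  shift-Ineqs l (a₁ , a₂) (b₁ , b₂) (c₁ , c₂) (h₁ , h₂ , h₃ , h₄ , h₅ , h₆) =
    +-monoˡ-< l h₁ , +-monoˡ-< l h₂ , +-monoˡ-< l h₃ , +-monoˡ-< l h₄ ,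
    subst₂ _<_ (sym ([x+k]-[y+k]≡x-y b₁ b₂ l)) (sym ([x+k]-[y+k]≡x-y a₁ a₂ l)) h₅ ,
    subst₂ _<_ (sym ([x+k]-[y+k]≡x-y a₁ a₂ l)) (sym ([x+k]-[y+k]≡x-y c₁ c₂ l)) h₆

  unshift-Ineqs : ∀ l a b c → Ineqs (shift l a) (shift l b) (shift l c) → Ineqs a b c
  unshift-Ineqs l (a₁ , a₂) (b₁ , b₂) (c₁ , c₂) (h₁ , h₂ , h₃ , h₄ , h₅ , h₆) =
    +-cancelʳ-< l h₁ , +-cancelʳ-< l h₂ , +-cancelʳ-< l h₃ , +-cancelʳ-< l h₄ ,
    subst₂ _<_ ([x+k]-[y+k]≡x-y b₁ b₂ l) ([x+k]-[y+k]≡x-y a₁ a₂ l) h₅ ,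
    subst₂ _<_ ([x+k]-[y+k]≡x-y a₁ a₂ l) ([x+k]-[y+k]≡x-y c₁ c₂ l) h₆

theorem1 : (R : RealField) →
    ((a b c : Tropical.Point R) →
      (Tropical.TransversalTriangle R a b c → Tropical.IneqsUpToRelabel R a b c) ×
      (Tropical.IneqsUpToRelabel R a b c → Tropical.TransversalTriangle R a b c)) ×
    ((λ' : RealField.ℝ R) (a b c : Tropical.Point R) →
      (Tropical.Ineqs R a b c →
        Tropical.Ineqs R (Tropical.shift R λ' a) (Tropical.shift R λ' b) (Tropical.shift R λ' c)) ×
      (Tropical.Ineqs R (Tropical.shift R λ' a) (Tropical.shift R λ' b) (Tropical.shift R λ' c) →
        Tropical.Ineqs R a b c))
theorem1 R =
  (λ a b c → TransversalTriangle⇒IneqsUpToRelabel a b c , IneqsUpToRelabel⇒TransversalTriangle a b c) ,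
  (λ l a b c → shift-Ineqs l a b c , unshift-Ineqs l a b c)
  where open TransversalTriangles R
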